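{- Let $n$ be a positive integer divisible by $8$ and $1\le k_1\le n/2$. Let $\mathcal{C}_1$ be a doubly even binary code of length $n$ and dimension $k_1$ with generator matrix $\begin{bmatrix}1&\mathbf{1}&\mathbf{1}\\0&I_{k_1-1}&A\end{bmatrix}$, where $A\in M_{(k_1-1)\times(n-k_1)}(\mathbf{Z})$ has all entries in $\{0,1\}$. Then the all-ones vector $\mathbf{1}\in\mathbf{Z}_2^{n-k_1}$ does not belong to the row space of $A\bmod 2$ over $\mathbf{Z}_2$.
   Context: $\mathbf{1}$ denotes an all-ones row vector of the appropriate length. An integer matrix $G\in M_{k\times n}(\mathbf{Z})$ is a generator matrix of the binary code $\mathcal{C}$ if $\mathcal{C}=\{aG\bmod 2: a\in\mathbf{Z}^k\}$. A binary code is doubly even if all Hamming weights are divisible by $4$. -}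

module Defs where

open import Data.Nat as ℕ using (ℕ; zero; suc)
open import Data.Integer as ℤ using (ℤ)
open import Data.Integer.DivMod using (_%ℕ_)
open import Data.Bool using (Bool; true; false; _∧_; _xor_)
open import Data.Fin using (Fin; zero; suc; splitAt)
open import Data.Sum using (inj₁; inj₂)
open import Data.Product using (∃)
open import Relation.Binary.PropositionalEquality using (_≡_)
open import Relation.Nullary.Decidable using (⌊_⌋)
open import Data.Fin using (_≟_)
open import Data.Bool using (if_then_else_)
open import Data.Nat.Divisibility using (_∣_)

Matrix : ℕ → ℕ → Set
Matrix k n = Fin k → Fin n → ℤ

Σℤ : ∀ {k} → (Fin k → ℤ) → ℤ
Σℤ {zero}  f = ℤ.0ℤ
Σℤ {suc k} f = f zero ℤ.+ Σℤ (λ i → f (suc i))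

_·_ : ∀ {k n} → (Fin k → ℤ) → Matrix k n → (Fin n → ℤ)
(a · G) j = Σℤ (λ i → a i ℤ.* G i j)

-- reduction mod 2 of an integer, as an element of Z_2 = Bool (true = 1)
mod2 : ℤ → Bool
mod2 x = ⌊ x %ℕ 2 ℕ.≟ 1 ⌋

BinVec : ℕ → Set
BinVec n = Fin n → Bool

BinCode : ℕ → Set₁
BinCode n = BinVec n → Set

CodeGen : ∀ {k n} → Matrix k n → BinCode n
CodeGen {k} G c = ∃ λ (a : Fin k → ℤ) → ∀ j → c j ≡ mod2 ((a · G) j)

weight : ∀ {n} → BinVec n → ℕ
weight {zero}  c = 0
weight {suc n} c = (if c zero then 1 else 0) ℕ.+ weight (λ j → c (suc j))

DoublyEven : ∀ {n} → BinCode n → Set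
DoublyEven {n} C = ∀ (c : BinVec n) → C c → 4 ∣ weight c

δ : ∀ {m} → Fin m → Fin m → ℤ
δ i j = if ⌊ i ≟ j ⌋ then ℤ.1ℤ else ℤ.0ℤ

-- the block generator matrix  [ 1  𝟏  𝟏 ; 0  I_m  A ]  of size (1+m) × (1+m+r),
-- with column blocks of widths 1, m, r
blockGen : ∀ {m r} → Matrix m r → Matrix (suc m) (suc m ℕ.+ r)
blockGen         A zero    zero    = ℤ.1ℤ
blockGen         A zero    (suc j) = ℤ.1ℤ
blockGen         A (suc i) zero    = ℤ.0ℤ
blockGen {m} {r} A (suc i) (suc j) with splitAt m {r} j
... | inj₁ j' = δ i j'
... | inj₂ l  = A i l

xorSum : ∀ {k} → (Fin k → Bool) → Bool
xorSum {zero}  f = false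
xorSum {suc k} f = f zero xor xorSum (λ i → f (suc i))

InRowSpaceMod2 : ∀ {m r} → Matrix m r → BinVec r → Set
InRowSpaceMod2 {m} A v =
  ∃ λ (x : Fin m → Bool) → ∀ j → v j ≡ xorSum (λ i → x i ∧ mod2 (A i j))

ones : ∀ {r} → BinVec r
ones _ = true

-- A doubly even binary code is self-orthogonal: from
--   wt u + wt v = wt (u ⊕ v) + 2 wt (u ∧ v)
-- every pair of codewords meets in an even number of positions.  Suppose x A = 𝟏 over Z₂.
-- Adding the first row of the generator matrix to x [0 I A] gives the codeword
-- u = (1, 𝟏 + x, 0), of weight 1 + P with P = wt (𝟏 + x), while (𝟏 + x) [0 I A] is a
-- codeword w = (0, 𝟏 + x, ∗) meeting u in exactly P positions.  So 1 + P and P are both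
-- even, which is impossible.
module Submission where

open import Defs
open import Data.Nat using (ℕ; zero; suc; _+_; _*_; _≤_)
open import Data.Nat.Properties
  using (+-comm; +-assoc; +-identityʳ; *-distribˡ-+; +-commutativeSemigroup)
open import Data.Nat.Divisibility
  using (_∣_; divides; ∣-trans; ∣m∣n⇒∣m+n; ∣m+n∣m⇒∣n; *-cancelˡ-∣; ∣1⇒≡1)
open import Data.Integer as ℤ using (ℤ; 0ℤ; 1ℤ)
open import Data.Bool using (Bool; true; false; _∧_; _xor_; not; if_then_else_)
open import Data.Bool.Properties
  using (∧-zeroʳ; ∧-identityʳ; ∧-idem; ∧-distribʳ-xor; xor-identityʳ; xor-∧-commutativeRing)
open import Algebra.Bundles using (CommutativeRing)
open import Algebra.Properties.CommutativeSemigroup +-commutativeSemigroup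
  using () renaming (interchange to +-interchange)
open import Algebra.Properties.CommutativeSemigroup
  (CommutativeRing.+-commutativeSemigroup xor-∧-commutativeRing)
  using () renaming (interchange to xor-interchange)
open import Data.Fin using (Fin; zero; suc; _↑ˡ_; _↑ʳ_; splitAt; _≟_)
open import Data.Fin.Properties using (splitAt-↑ˡ; splitAt-↑ʳ)
open import Data.Product using (_,_)
open import Data.Sum using (_⊎_; inj₁; inj₂)
open import Data.Vec.Functional using (_∷_)
open import Relation.Binary.PropositionalEquality
  using (_≡_; refl; sym; trans; cong; cong₂; subst; module ≡-Reasoning)
open import Relation.Nullary using (¬_)
open import Relation.Nullary.Decidable using (⌊_⌋; does; isYes≗does)
open ≡-Reasoning

indicator : Bool → ℕ
indicator b = if b then 1 else 0

weight-cong : ∀ {n} {f g : BinVec n} → (∀ j → f j ≡ g j) → weight f ≡ weight g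
weight-cong {zero}  e = refl
weight-cong {suc n} e = cong₂ _+_ (cong indicator (e zero)) (weight-cong (λ j → e (suc j)))

weight-false : ∀ {n} {f : BinVec n} → (∀ j → f j ≡ false) → weight f ≡ 0
weight-false {zero}  e = refl
weight-false {suc n} e = cong₂ _+_ (cong indicator (e zero)) (weight-false (λ j → e (suc j)))

weight-↑ : ∀ m {r} (g : BinVec (m + r)) →
  weight g ≡ weight (λ k → g (k ↑ˡ r)) + weight (λ l → g (m ↑ʳ l))
weight-↑ zero    g = refl
weight-↑ (suc m) g =
  trans (cong (indicator (g zero) +_) (weight-↑ m (λ j → g (suc j))))
        (sym (+-assoc (indicator (g zero)) _ _))

weight-xor : ∀ {n} (u v : BinVec n) →
  weight u + weight v ≡ weight (λ j → u j xor v j) + 2 * weight (λ j → u j ∧ v j)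
weight-xor {zero}  u v = refl
weight-xor {suc n} u v = begin
  (indicator a + weight u′) + (indicator b + weight v′)
    ≡⟨ +-interchange (indicator a) (weight u′) (indicator b) (weight v′) ⟩
  (indicator a + indicator b) + (weight u′ + weight v′)
    ≡⟨ cong₂ _+_ (indicator-xor a b) (weight-xor u′ v′) ⟩
  (indicator (a xor b) + 2 * indicator (a ∧ b)) + (X + 2 * Y)
    ≡⟨ +-interchange (indicator (a xor b)) (2 * indicator (a ∧ b)) X (2 * Y) ⟩
  (indicator (a xor b) + X) + (2 * indicator (a ∧ b) + 2 * Y)
    ≡⟨ cong (indicator (a xor b) + X +_) (sym (*-distribˡ-+ 2 (indicator (a ∧ b)) Y)) ⟩
  (indicator (a xor b) + X) + 2 * (indicator (a ∧ b) + Y) ∎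
  where
  a = u zero
  b = v zero
  u′ v′ : BinVec n
  u′ j = u (suc j)
  v′ j = v (suc j)
  X = weight (λ j → u′ j xor v′ j)
  Y = weight (λ j → u′ j ∧ v′ j)
  indicator-xor : ∀ a b → indicator a + indicator b ≡ indicator (a xor b) + 2 * indicator (a ∧ b)
  indicator-xor true  true  = refl
  indicator-xor true  false = refl
  indicator-xor false true  = refl
  indicator-xor false false = refl

xorSum-cong : ∀ {k} {f g : Fin k → Bool} → (∀ i → f i ≡ g i) → xorSum f ≡ xorSum g
xorSum-cong {zero}  e = refl
xorSum-cong {suc k} e = cong₂ _xor_ (e zero) (xorSum-cong (λ i → e (suc i)))

xorSum-false : ∀ {k} {f : Fin k → Bool} → (∀ i → f i ≡ false) → xorSum f ≡ false
xorSum-false {zero}  e = refl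
xorSum-false {suc k} e = cong₂ _xor_ (e zero) (xorSum-false (λ i → e (suc i)))

xorSum-xor : ∀ {k} (f g : Fin k → Bool) →
  xorSum (λ i → f i xor g i) ≡ xorSum f xor xorSum g
xorSum-xor {zero}  f g = refl
xorSum-xor {suc k} f g =
  trans (cong ((f zero xor g zero) xor_) (xorSum-xor (λ i → f (suc i)) (λ i → g (suc i))))
        (xor-interchange (f zero) (g zero) _ _)

mod2-suc : ∀ n → mod2 (ℤ.+ suc n) ≡ not (mod2 (ℤ.+ n))
mod2-suc zero          = refl
mod2-suc (suc zero)    = refl
mod2-suc (suc (suc n)) = mod2-suc n

mod2-weight : ∀ {k} (f : Fin k → Bool) → mod2 (ℤ.+ weight f) ≡ xorSum f
mod2-weight {zero}  f = refl
mod2-weight {suc k} f with f zero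
... | true  = trans (mod2-suc (weight (λ i → f (suc i)))) (cong not (mod2-weight (λ i → f (suc i))))
... | false = mod2-weight (λ i → f (suc i))

bit : Bool → ℤ
bit b = if b then 1ℤ else 0ℤ

bit-∧ : ∀ a b → bit a ℤ.* bit b ≡ bit (a ∧ b)
bit-∧ true  true  = refl
bit-∧ true  false = refl
bit-∧ false b     = refl

ZeroOne : ℤ → Set
ZeroOne x = x ≡ 0ℤ ⊎ x ≡ 1ℤ

bit-ZeroOne : ∀ b → ZeroOne (bit b)
bit-ZeroOne true  = inj₂ refl
bit-ZeroOne false = inj₁ refl

bit-mod2 : ∀ {x} → ZeroOne x → bit (mod2 x) ≡ x
bit-mod2 (inj₁ refl) = refl
bit-mod2 (inj₂ refl) = refl

Σℤ-cong : ∀ {k} {f g : Fin k → ℤ} → (∀ i → f i ≡ g i) → Σℤ f ≡ Σℤ g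
Σℤ-cong {zero}  e = refl
Σℤ-cong {suc k} e = cong₂ ℤ._+_ (e zero) (Σℤ-cong (λ i → e (suc i)))

Σℤ-bit : ∀ {k} (f : Fin k → Bool) → Σℤ (λ i → bit (f i)) ≡ ℤ.+ weight f
Σℤ-bit {zero}  f = refl
Σℤ-bit {suc k} f with f zero
... | true  = cong (λ t → 1ℤ ℤ.+ t) (Σℤ-bit (λ i → f (suc i)))
... | false = cong (λ t → 0ℤ ℤ.+ t) (Σℤ-bit (λ i → f (suc i)))

reduce : ∀ {k n} → Matrix k n → Fin k → BinVec n
reduce G i j = mod2 (G i j)

linComb : ∀ {k n} → (Fin k → Bool) → (Fin k → BinVec n) → BinVec n
linComb y B j = xorSum (λ i → y i ∧ B i j)

linComb-xor : ∀ {k n} (y z : Fin k → Bool) (B : Fin k → BinVec n) j →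
  linComb (λ i → y i xor z i) B j ≡ linComb y B j xor linComb z B j
linComb-xor y z B j =
  trans (xorSum-cong (λ i → ∧-distribʳ-xor (B i j) (y i) (z i)))
        (xorSum-xor (λ i → y i ∧ B i j) (λ i → z i ∧ B i j))

linComb-∈-CodeGen : ∀ {k n} {G : Matrix k n} → (∀ i j → ZeroOne (G i j)) →
  ∀ y → CodeGen G (linComb y (reduce G))
linComb-∈-CodeGen {G = G} G01 y = (λ i → bit (y i)) , λ j → sym (begin
  mod2 (Σℤ (λ i → bit (y i) ℤ.* G i j))
    ≡⟨ cong mod2 (Σℤ-cong (λ i → trans (cong (bit (y i) ℤ.*_) (sym (bit-mod2 (G01 i j))))
                                        (bit-∧ (y i) (reduce G i j)))) ⟩
  mod2 (Σℤ (λ i → bit (y i ∧ reduce G i j)))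
    ≡⟨ cong mod2 (Σℤ-bit (λ i → y i ∧ reduce G i j)) ⟩
  mod2 (ℤ.+ weight (λ i → y i ∧ reduce G i j))
    ≡⟨ mod2-weight (λ i → y i ∧ reduce G i j) ⟩
  linComb y (reduce G) j ∎)

doublyEven-orthogonal : ∀ {n} {C : BinCode n} → DoublyEven C →
  ∀ {u v w} → C u → C v → C w → (∀ j → w j ≡ u j xor v j) →
  2 ∣ weight (λ j → u j ∧ v j)
doublyEven-orthogonal even {u} {v} {w} u∈C v∈C w∈C w≡u⊕v = *-cancelˡ-∣ 2 4∣2uv
  where
  4∣u⊕v+2uv : 4 ∣ weight (λ j → u j xor v j) + 2 * weight (λ j → u j ∧ v j)
  4∣u⊕v+2uv = subst (4 ∣_) (weight-xor u v) (∣m∣n⇒∣m+n (even u u∈C) (even v v∈C))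
  4∣2uv : 4 ∣ 2 * weight (λ j → u j ∧ v j)
  4∣2uv = ∣m+n∣m⇒∣n 4∣u⊕v+2uv (subst (4 ∣_) (weight-cong w≡u⊕v) (even w w∈C))

codeGen-orthogonal : ∀ {k n} {G : Matrix k n} → (∀ i j → ZeroOne (G i j)) →
  DoublyEven (CodeGen G) → ∀ y z →
  2 ∣ weight (λ j → linComb y (reduce G) j ∧ linComb z (reduce G) j)
codeGen-orthogonal {G = G} G01 even y z =
  doublyEven-orthogonal even (linComb-∈-CodeGen G01 y) (linComb-∈-CodeGen G01 z)
    (linComb-∈-CodeGen G01 (λ i → y i xor z i)) (linComb-xor y z (reduce G))

-- Stated with `does`, which (unlike `⌊_⌋`) computes on `suc i ≟ suc k`; xorSum-δ relies on that.
mod2-δ : ∀ {m} (i k : Fin m) → mod2 (δ i k) ≡ does (i ≟ k)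
mod2-δ i k = trans (mod2-bit ⌊ i ≟ k ⌋) (isYes≗does (i ≟ k))
  where
  mod2-bit : ∀ b → mod2 (bit b) ≡ b
  mod2-bit true  = refl
  mod2-bit false = refl

xorSum-δ : ∀ {m} (x : Fin m → Bool) k → xorSum (λ i → x i ∧ does (i ≟ k)) ≡ x k
xorSum-δ {suc m} x zero =
  trans (cong₂ _xor_ (∧-identityʳ (x zero)) (xorSum-false (λ i → ∧-zeroʳ (x (suc i)))))
        (xor-identityʳ (x zero))
xorSum-δ {suc m} x (suc k) =
  trans (cong (_xor xorSum (λ i → x (suc i) ∧ does (i ≟ k))) (∧-zeroʳ (x zero)))
        (xorSum-δ (λ i → x (suc i)) k)

blockGen-ZeroOne : ∀ {m r} {A : Matrix m r} → (∀ i j → ZeroOne (A i j)) →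
  ∀ i j → ZeroOne (blockGen A i j)
blockGen-ZeroOne             A01 zero    zero    = inj₂ refl
blockGen-ZeroOne             A01 zero    (suc j) = inj₂ refl
blockGen-ZeroOne             A01 (suc i) zero    = inj₁ refl
blockGen-ZeroOne {m} {r} A01 (suc i) (suc j) with splitAt m {r} j
... | inj₁ k = bit-ZeroOne ⌊ i ≟ k ⌋
... | inj₂ l = A01 i l

module _ {m r} (A : Matrix m r) (b : Bool) (x : Fin m → Bool) where

  private
    word : BinVec (suc m + r)
    word = linComb (b ∷ x) (reduce (blockGen A))

  blockGen-linComb-zero : word zero ≡ b
  blockGen-linComb-zero =
    trans (cong₂ _xor_ (∧-identityʳ b) (xorSum-false (λ i → ∧-zeroʳ (x i)))) (xor-identityʳ b)

  blockGen-linComb-↑ˡ : ∀ k → word (suc (k ↑ˡ r)) ≡ b xor x k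
  blockGen-linComb-↑ˡ k = cong₂ _xor_ (∧-identityʳ b) (begin
    xorSum (λ i → x i ∧ mod2 (blockGen A (suc i) (suc (k ↑ˡ r))))
      ≡⟨ xorSum-cong (λ i → cong (λ t → x i ∧ mod2 t) (identity-entry i)) ⟩
    xorSum (λ i → x i ∧ mod2 (δ i k))
      ≡⟨ xorSum-cong (λ i → cong (x i ∧_) (mod2-δ i k)) ⟩
    xorSum (λ i → x i ∧ does (i ≟ k))
      ≡⟨ xorSum-δ x k ⟩
    x k ∎)
    where
    identity-entry : ∀ i → blockGen A (suc i) (suc (k ↑ˡ r)) ≡ δ i k
    identity-entry i rewrite splitAt-↑ˡ m k r = refl

  blockGen-linComb-↑ʳ : ∀ l → word (suc (m ↑ʳ l)) ≡ b xor linComb x (reduce A) l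
  blockGen-linComb-↑ʳ l =
    cong₂ _xor_ (∧-identityʳ b) (xorSum-cong (λ i → cong (λ t → x i ∧ mod2 t) (A-entry i)))
    where
    A-entry : ∀ i → blockGen A (suc i) (suc (m ↑ʳ l)) ≡ A i l
    A-entry i rewrite splitAt-↑ʳ m r l = refl

weight-blocks : ∀ m {r} (g : BinVec (suc m + r)) {b f} →
  g zero ≡ b → (∀ k → g (suc (k ↑ˡ r)) ≡ f k) → (∀ l → g (suc (m ↑ʳ l)) ≡ false) →
  weight g ≡ indicator b + weight f
weight-blocks m {r} g {b} {f} g₀ gˡ gʳ = begin
  indicator (g zero) + weight (λ j → g (suc j))
    ≡⟨ cong₂ _+_ (cong indicator g₀) (weight-↑ m (λ j → g (suc j))) ⟩
  indicator b + (weight (λ k → g (suc (k ↑ˡ r))) + weight (λ l → g (suc (m ↑ʳ l))))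
    ≡⟨ cong (indicator b +_) (cong₂ _+_ (weight-cong gˡ) (weight-false gʳ)) ⟩
  indicator b + (weight f + 0)
    ≡⟨ cong (indicator b +_) (+-identityʳ (weight f)) ⟩
  indicator b + weight f ∎

2∤-suc : ∀ {n} → 2 ∣ n → ¬ 2 ∣ suc n
2∤-suc {n} 2∣n 2∣1+n with ∣1⇒≡1 (∣m+n∣m⇒∣n (subst (2 ∣_) (+-comm 1 n) 2∣1+n) 2∣n)
... | ()

lemma5p1 : (m r : ℕ) → 8 ∣ (suc m + r) → 2 * suc m ≤ suc m + r →
    (A : Fin m → Fin r → ℤ) → (∀ i j → A i j ≡ 0ℤ ⊎ A i j ≡ 1ℤ) →
    DoublyEven (CodeGen (blockGen A)) →
    ¬ InRowSpaceMod2 A ones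
lemma5p1 m r _ _ A A01 even (x , 𝟏≡xA) =
  2∤-suc (subst (2 ∣_) weight-u∧w (codeGen-orthogonal G01 even y z))
         (subst (2 ∣_) weight-u (∣-trans (divides 2 refl) (even u (linComb-∈-CodeGen G01 y))))
  where
  G01 : ∀ i j → ZeroOne (blockGen A i j)
  G01 = blockGen-ZeroOne A01
  x̄ : Fin m → Bool
  x̄ i = not (x i)
  y z : Fin (suc m) → Bool
  y = true ∷ x
  z = false ∷ x̄
  u w : BinVec (suc m + r)
  u = linComb y (reduce (blockGen A))
  w = linComb z (reduce (blockGen A))
  u-↑ʳ : ∀ l → u (suc (m ↑ʳ l)) ≡ false
  u-↑ʳ l = trans (blockGen-linComb-↑ʳ A true x l) (cong not (sym (𝟏≡xA l)))
  weight-u : weight u ≡ suc (weight x̄)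
  weight-u =
    weight-blocks m u (blockGen-linComb-zero A true x) (blockGen-linComb-↑ˡ A true x) u-↑ʳ
  weight-u∧w : weight (λ j → u j ∧ w j) ≡ weight x̄
  weight-u∧w = weight-blocks m (λ j → u j ∧ w j)
    (cong₂ _∧_ (blockGen-linComb-zero A true x) (blockGen-linComb-zero A false x̄))
    (λ k → trans (cong₂ _∧_ (blockGen-linComb-↑ˡ A true x k) (blockGen-linComb-↑ˡ A false x̄ k))
                 (∧-idem (x̄ k)))
    (λ l → cong (_∧ w (suc (m ↑ʳ l))) (u-↑ʳ l))
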